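{- Let $h \ge 3$ and $v \in V(Q_h)$. If $1 \le i \le h-3$, then $L^v_i \cup L^v_{i+2}$ is not a mutual-visibility set of $Q_h$.
   Context: $Q_h$ is the hypercube with vertex set $\{0,1\}^h$, two strings adjacent iff they differ in exactly one position. For a vertex $v$ and $i \ge 0$, $L^v_i$ is the set of vertices at distance exactly $i$ from $v$. For $M \subseteq V(G)$, a $u,v$-path is $M$-free if it contains no vertex of $M\setminus\{u,v\}$; $u,v$ are $M$-visible if there is an $M$-free shortest $u,v$-path; $M$ is a mutual-visibility set if every two vertices of $M$ are $M$-visible. -}

module Defs where

open import Data.Bool using (Bool; true; false)
open import Data.Nat using (ℕ; zero; suc; _+_; _≤_)
open import Data.Vec using (Vec; []; _∷_)
open import Data.List using (List; []; _∷_)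
open import Data.List.Relation.Unary.All using (All)
open import Data.Product using (Σ; _×_)
open import Data.Sum using (_⊎_)
open import Relation.Binary.PropositionalEquality using (_≡_)
open import Relation.Nullary using (¬_)

V : ℕ → Set
V h = Vec Bool h

diffCount : ∀ {h} → V h → V h → ℕ
diffCount [] [] = 0
diffCount (true ∷ xs) (true ∷ ys) = diffCount xs ys
diffCount (false ∷ xs) (false ∷ ys) = diffCount xs ys
diffCount (true ∷ xs) (false ∷ ys) = suc (diffCount xs ys)
diffCount (false ∷ xs) (true ∷ ys) = suc (diffCount xs ys)

Adj : ∀ {h} → V h → V h → Set
Adj x y = diffCount x y ≡ 1

data Walk {h : ℕ} : V h → V h → ℕ → Set where
  here : ∀ {u} → Walk u u 0
  step : ∀ {u w v k} → Adj u w → Walk w v k → Walk u v (suc k)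

vertices : ∀ {h} {u v : V h} {k} → Walk u v k → List (V h)
vertices {u = u} here = u ∷ []
vertices {u = u} (step _ p) = u ∷ vertices p

IsDist : ∀ {h} → V h → V h → ℕ → Set
IsDist u v d = Walk u v d × (∀ k → Walk u v k → d ≤ k)

Layer : ∀ {h} → V h → ℕ → V h → Set
Layer v i x = IsDist v x i

VSet : ℕ → Set₁
VSet h = V h → Set

MFree : ∀ {h} (M : VSet h) {u v : V h} {k} → Walk u v k → Set
MFree M {u} {v} p = All (λ x → M x → (x ≡ u) ⊎ (x ≡ v)) (vertices p)

Visible : ∀ {h} → VSet h → V h → V h → Set
Visible M u v = Σ ℕ (λ d → IsDist u v d × Σ (Walk u v d) (λ p → MFree M p))

MutualVisibilitySet : ∀ {h} → VSet h → Set
MutualVisibilitySet M = ∀ u v → M u → M v → Visible M u v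

{-# OPTIONS --safe #-}
-- Along an edge of Q_h the distance to v changes by exactly one.  Hence the
-- midpoint of a geodesic of length 4 from a vertex at distance i to one at
-- distance i + 2 lies at distance i or i + 2 from v, and so blocks the
-- geodesic.  A pair u ∈ L^v_i, w ∈ L^v_{i+2} with d(u, w) = 4 must share
-- i − 1 flipped coordinates and use i + 3 in total, which is possible exactly
-- when 1 ≤ i ≤ h − 3.
module Submission where

open import Defs
open import Data.Nat using (ℕ; zero; suc; _+_; _∸_; _≤_; z≤n; s≤s)
open import Data.Nat.Properties
  using (module ≤-Reasoning; ≤-trans; ≤-reflexive; ≤-antisym; +-mono-≤; +-monoʳ-≤;
         +-suc; +-comm; n≤1+n; m+1+n≰m; m+n≤o⇒m≤o; m≤o∸n⇒m+n≤o; suc-injective)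
open import Data.Bool using (Bool; true; false; not)
open import Data.Vec using ([]; _∷_)
open import Data.List.Relation.Unary.All using (_∷_)
open import Data.Product using (_×_; _,_; ∃₂)
open import Data.Sum using (_⊎_; inj₁; inj₂; [_,_]′)
import Data.Sum as Sum
open import Data.Empty using (⊥-elim)
open import Relation.Nullary using (¬_)
open import Relation.Binary.PropositionalEquality
  using (_≡_; refl; sym; trans; cong; subst; module ≡-Reasoning)

diffCount-refl : ∀ {h} (x : V h) → diffCount x x ≡ 0
diffCount-refl []          = refl
diffCount-refl (true ∷ x)  = diffCount-refl x
diffCount-refl (false ∷ x) = diffCount-refl x

diffCount≡0⇒≡ : ∀ {h} {x y : V h} → diffCount x y ≡ 0 → x ≡ y
diffCount≡0⇒≡ {x = []}        {[]}        _  = refl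
diffCount≡0⇒≡ {x = true ∷ x}  {true ∷ y}  eq = cong (true ∷_) (diffCount≡0⇒≡ eq)
diffCount≡0⇒≡ {x = false ∷ x} {false ∷ y} eq = cong (false ∷_) (diffCount≡0⇒≡ eq)

diffCount-triangle : ∀ {h} (x y z : V h) → diffCount x z ≤ diffCount x y + diffCount y z
diffCount-triangle []          []          []          = z≤n
diffCount-triangle (true ∷ x)  (true ∷ y)  (true ∷ z)  = diffCount-triangle x y z
diffCount-triangle (false ∷ x) (false ∷ y) (false ∷ z) = diffCount-triangle x y z
diffCount-triangle (true ∷ x)  (false ∷ y) (false ∷ z) = s≤s (diffCount-triangle x y z)
diffCount-triangle (false ∷ x) (true ∷ y)  (true ∷ z)  = s≤s (diffCount-triangle x y z)
diffCount-triangle (true ∷ x)  (true ∷ y)  (false ∷ z) =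
  ≤-trans (s≤s (diffCount-triangle x y z)) (≤-reflexive (sym (+-suc _ _)))
diffCount-triangle (false ∷ x) (false ∷ y) (true ∷ z)  =
  ≤-trans (s≤s (diffCount-triangle x y z)) (≤-reflexive (sym (+-suc _ _)))
diffCount-triangle (true ∷ x)  (false ∷ y) (true ∷ z)  =
  ≤-trans (diffCount-triangle x y z) (+-mono-≤ (n≤1+n _) (n≤1+n _))
diffCount-triangle (false ∷ x) (true ∷ y)  (false ∷ z) =
  ≤-trans (diffCount-triangle x y z) (+-mono-≤ (n≤1+n _) (n≤1+n _))

diffCount≤length : ∀ {h} {x y : V h} {k} → Walk x y k → diffCount x y ≤ k
diffCount≤length {x = x} here = ≤-reflexive (diffCount-refl x)
diffCount≤length {x = x} {y} (step {w = w} {k = k} x~w w⇝y) = begin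
  diffCount x y                 ≤⟨ diffCount-triangle x w y ⟩
  diffCount x w + diffCount w y ≡⟨ cong (_+ diffCount w y) x~w ⟩
  suc (diffCount w y)           ≤⟨ s≤s (diffCount≤length w⇝y) ⟩
  suc k                         ∎
  where open ≤-Reasoning

Walk-∷ : ∀ {h} (b : Bool) {x y : V h} {k} → Walk x y k → Walk (b ∷ x) (b ∷ y) k
Walk-∷ b here                 = here
Walk-∷ b (step {w = w} x~w p) = step (Adj-∷ b) (Walk-∷ b p)
  where
  Adj-∷ : ∀ b → Adj (b ∷ _) (b ∷ w)
  Adj-∷ true  = x~w
  Adj-∷ false = x~w

geodesic : ∀ {h} (x y : V h) → Walk x y (diffCount x y)
geodesic []          []          = here
geodesic (true ∷ x)  (true ∷ y)  = Walk-∷ true (geodesic x y)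
geodesic (false ∷ x) (false ∷ y) = Walk-∷ false (geodesic x y)
geodesic (true ∷ x)  (false ∷ y) = step (cong suc (diffCount-refl x)) (Walk-∷ false (geodesic x y))
geodesic (false ∷ x) (true ∷ y)  = step (cong suc (diffCount-refl x)) (Walk-∷ true (geodesic x y))

IsDist-diffCount : ∀ {h} (x y : V h) → IsDist x y (diffCount x y)
IsDist-diffCount x y = geodesic x y , λ _ → diffCount≤length

IsDist⇒≡diffCount : ∀ {h} {x y : V h} {d} → IsDist x y d → d ≡ diffCount x y
IsDist⇒≡diffCount {x = x} {y} (p , minimal) =
  ≤-antisym (minimal _ (geodesic x y)) (diffCount≤length p)

diffCount≡⇒Layer : ∀ {h} {v x : V h} {i} → diffCount v x ≡ i → Layer v i x
diffCount≡⇒Layer {v = v} {x} eq = subst (IsDist v x) eq (IsDist-diffCount v x)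

Adj⇒diffCount-suc⊎pred : ∀ {h} (v : V h) {x y : V h} → Adj x y →
  diffCount v y ≡ suc (diffCount v x) ⊎ diffCount v x ≡ suc (diffCount v y)
Adj⇒diffCount-suc⊎pred []          {[]}        {[]}        ()
Adj⇒diffCount-suc⊎pred (true ∷ v)  {true ∷ x}  {true ∷ y}  x~y = Adj⇒diffCount-suc⊎pred v x~y
Adj⇒diffCount-suc⊎pred (false ∷ v) {false ∷ x} {false ∷ y} x~y = Adj⇒diffCount-suc⊎pred v x~y
Adj⇒diffCount-suc⊎pred (true ∷ v)  {false ∷ x} {false ∷ y} x~y =
  Sum.map (cong suc) (cong suc) (Adj⇒diffCount-suc⊎pred v x~y)
Adj⇒diffCount-suc⊎pred (false ∷ v) {true ∷ x}  {true ∷ y}  x~y =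
  Sum.map (cong suc) (cong suc) (Adj⇒diffCount-suc⊎pred v x~y)
Adj⇒diffCount-suc⊎pred (true ∷ v)  {true ∷ x}  {false ∷ y} x~y
  rewrite diffCount≡0⇒≡ {x = x} {y} (suc-injective x~y) = inj₁ refl
Adj⇒diffCount-suc⊎pred (false ∷ v) {false ∷ x} {true ∷ y}  x~y
  rewrite diffCount≡0⇒≡ {x = x} {y} (suc-injective x~y) = inj₁ refl
Adj⇒diffCount-suc⊎pred (true ∷ v)  {false ∷ x} {true ∷ y}  x~y
  rewrite diffCount≡0⇒≡ {x = x} {y} (suc-injective x~y) = inj₂ refl
Adj⇒diffCount-suc⊎pred (false ∷ v) {true ∷ x}  {false ∷ y} x~y
  rewrite diffCount≡0⇒≡ {x = x} {y} (suc-injective x~y) = inj₂ refl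

midpoint-diffCount : ∀ {h} (v : V h) {u m w : V h} → Walk u m 2 → Walk m w 2 →
  diffCount v w ≡ diffCount v u + 2 →
  diffCount v m ≡ diffCount v u ⊎ diffCount v m ≡ diffCount v u + 2
midpoint-diffCount v {u} {m} {w} (step u~x (step x~m here)) m⇝w w-far
  with Adj⇒diffCount-suc⊎pred v u~x | Adj⇒diffCount-suc⊎pred v x~m
... | inj₁ up₁   | inj₁ up₂   = inj₂ (trans up₂ (trans (cong suc up₁) (+-comm 2 _)))
... | inj₁ up    | inj₂ down  = inj₁ (suc-injective (trans (sym down) up))
... | inj₂ down  | inj₁ up    = inj₁ (trans up (sym down))
... | inj₂ down₁ | inj₂ down₂ = ⊥-elim (m+1+n≰m (diffCount v u) too-close)
  where
  too-close : diffCount v u + 2 ≤ diffCount v u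
  too-close = begin
    diffCount v u + 2             ≡⟨ sym w-far ⟩
    diffCount v w                 ≤⟨ diffCount-triangle v m w ⟩
    diffCount v m + diffCount m w ≤⟨ +-monoʳ-≤ (diffCount v m) (diffCount≤length m⇝w) ⟩
    diffCount v m + 2             ≡⟨ +-comm (diffCount v m) 2 ⟩
    suc (suc (diffCount v m))     ≡⟨ cong suc (sym down₂) ⟩
    suc (diffCount v _)           ≡⟨ sym down₁ ⟩
    diffCount v u                 ∎
    where open ≤-Reasoning

TwoLayers : ∀ {h} → V h → ℕ → VSet h
TwoLayers v i x = Layer v i x ⊎ Layer v (i + 2) x

midpoint-blocks-geodesic : ∀ {h} (v : V h) {u w : V h} {i} →
  diffCount u w ≡ 4 → diffCount v u ≡ i → diffCount v w ≡ i + 2 →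
  (p : Walk u w 4) → ¬ MFree (TwoLayers v i) p
midpoint-blocks-geodesic v {u} {w} u-w refl w-far
  (step u~x (step {w = m} x~m (step m~y (step y~w here)))) (_ ∷ _ ∷ m-free ∷ _) =
  [ (λ { refl → no-shortcut m⇝w }) , (λ { refl → no-shortcut u⇝m }) ]′ (m-free m∈TwoLayers)
  where
  u⇝m : Walk u m 2
  u⇝m = step u~x (step x~m here)

  m⇝w : Walk m w 2
  m⇝w = step m~y (step y~w here)

  m∈TwoLayers : TwoLayers v (diffCount v u) m
  m∈TwoLayers = Sum.map diffCount≡⇒Layer diffCount≡⇒Layer (midpoint-diffCount v u⇝m m⇝w w-far)

  no-shortcut : ¬ Walk u w 2
  no-shortcut p with subst (_≤ 2) u-w (diffCount≤length p)
  ... | s≤s (s≤s ())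

¬Visible-across-gap : ∀ {h} (v : V h) {u w : V h} {i} →
  diffCount u w ≡ 4 → diffCount v u ≡ i → diffCount v w ≡ i + 2 →
  ¬ Visible (TwoLayers v i) u w
¬Visible-across-gap v u-w v-u v-w (d , d-dist , p , p-free)
  with trans (IsDist⇒≡diffCount d-dist) u-w
... | refl = midpoint-blocks-geodesic v u-w v-u v-w p p-free

flipN : ∀ {h} → ℕ → V h → V h
flipN zero    x       = x
flipN (suc n) []      = []
flipN (suc n) (b ∷ x) = not b ∷ flipN n x

diffCount-∷-∷ : ∀ {h} b (x y : V h) → diffCount (b ∷ x) (b ∷ y) ≡ diffCount x y
diffCount-∷-∷ true  x y = refl
diffCount-∷-∷ false x y = refl

diffCount-∷-not∷ : ∀ {h} b (x y : V h) → diffCount (b ∷ x) (not b ∷ y) ≡ suc (diffCount x y)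
diffCount-∷-not∷ true  x y = refl
diffCount-∷-not∷ false x y = refl

diffCount-not∷-∷ : ∀ {h} b (x y : V h) → diffCount (not b ∷ x) (b ∷ y) ≡ suc (diffCount x y)
diffCount-not∷-∷ true  x y = refl
diffCount-not∷-∷ false x y = refl

diffCount-flipN : ∀ {h} k (x : V h) → k ≤ h → diffCount x (flipN k x) ≡ k
diffCount-flipN zero    x       _         = diffCount-refl x
diffCount-flipN (suc k) (b ∷ x) (s≤s k≤h) =
  trans (diffCount-∷-not∷ b x (flipN k x)) (cong suc (diffCount-flipN k x k≤h))

diffCount-flipN-flipN : ∀ {h} m k (x : V h) → m + k ≤ h →
  diffCount (flipN m x) (flipN (m + k) x) ≡ k
diffCount-flipN-flipN zero    k x       le       = diffCount-flipN k x le
diffCount-flipN-flipN (suc m) k (b ∷ x) (s≤s le) =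
  trans (diffCount-∷-∷ (not b) _ _) (diffCount-flipN-flipN m k x le)

-- u flips coordinates 0 … i − 1 of v and w flips coordinates 1 … i + 2.
pair-across-gap : ∀ {h} (v : V h) {i} → 1 ≤ i → i + 3 ≤ h →
  ∃₂ λ u w → diffCount v u ≡ i × diffCount v w ≡ i + 2 × diffCount u w ≡ 4
pair-across-gap (b ∷ v) {suc j} _ (s≤s j+3≤h) =
  flipN (suc j) (b ∷ v) , b ∷ flipN (j + 3) v , v-u , v-w , u-w
  where
  v-u : diffCount (b ∷ v) (flipN (suc j) (b ∷ v)) ≡ suc j
  v-u = diffCount-flipN (suc j) (b ∷ v) (s≤s (m+n≤o⇒m≤o j j+3≤h))

  v-w : diffCount (b ∷ v) (b ∷ flipN (j + 3) v) ≡ suc j + 2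
  v-w = begin
    diffCount (b ∷ v) (b ∷ flipN (j + 3) v) ≡⟨ diffCount-∷-∷ b v _ ⟩
    diffCount v (flipN (j + 3) v)           ≡⟨ diffCount-flipN (j + 3) v j+3≤h ⟩
    j + 3                                   ≡⟨ +-suc j 2 ⟩
    suc j + 2                               ∎
    where open ≡-Reasoning

  u-w : diffCount (flipN (suc j) (b ∷ v)) (b ∷ flipN (j + 3) v) ≡ 4
  u-w = trans (diffCount-not∷-∷ b _ _) (cong suc (diffCount-flipN-flipN j 3 v j+3≤h))

proposition3p3 : (h : ℕ) → 3 ≤ h → (v : V h) → (i : ℕ) → 1 ≤ i → i ≤ h ∸ 3 →
    ¬ MutualVisibilitySet {h} (λ x → Layer v i x ⊎ Layer v (i + 2) x)
proposition3p3 h 3≤h v i 1≤i i≤h∸3 mutually-visible =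
  let u , w , v-u , v-w , u-w = pair-across-gap v 1≤i (m≤o∸n⇒m+n≤o i 3≤h i≤h∸3)
  in  ¬Visible-across-gap v u-w v-u v-w
        (mutually-visible u w (inj₁ (diffCount≡⇒Layer v-u)) (inj₂ (diffCount≡⇒Layer v-w)))
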